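{- Let $\mathcal{M}$ be a 4-orbit $(n-1)$-maniplex. Then one of the following holds: (1) $\mathcal{M}$ is fully-transitive; (2) there exists $i\in\{0,\dots,n-1\}$ such that $\mathcal{M}$ is $j$-face-transitive for all $j\neq i$; (3) there exist $i,k\in\{0,\dots,n-1\}$ with $i\neq k$ such that $\mathcal{M}$ is $j$-face-transitive for all $j\neq i,k$; (4) there exists $i\in\{0,\dots,n-1\}$ such that $\mathcal{M}$ is $j$-face-transitive for all $j\notin\{i-1,i,i+1\}$.
   Context: An $(n-1)$-maniplex is given by a connected simple graph (flag graph), whose vertices are called flags, with a proper edge-colouring by colours $\{0,\dots,n-1\}$, each colour class a perfect matching, such that for colours $i,j$ with $|i-j|\ge2$ each component of the subgraph spanned by colours $i,j$ is a 4-cycle. Automorphisms are colour-preserving graph automorphisms; 4-orbit means exactly 4 orbits on flags. A $j$-face is a connected component of the flag graph with the $j$-edges removed; $\mathcal{M}$ is $j$-face-transitive if $\mathrm{Aut}(\mathcal{M})$ is transitive on $j$-faces, and fully-transitive if it is $j$-face-transitive for all $j\in\{0,\dots,n-1\}$. -}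

module Defs where

open import Level using (0ℓ)
open import Data.Nat using (ℕ; _+_; _≤_)
open import Data.Fin using (Fin; toℕ)
open import Data.Product using (Σ; _×_; ∃; ∃-syntax)
open import Data.Sum using (_⊎_)
open import Relation.Binary.PropositionalEquality using (_≡_; _≢_)
open import Relation.Binary.Construct.Closure.ReflexiveTransitive using (Star)

FarApart : {n : ℕ} → Fin n → Fin n → Set
FarApart i j = (toℕ i + 2 ≤ toℕ j) ⊎ (toℕ j + 2 ≤ toℕ i)

-- An (n-1)-maniplex, presented by its flag graph: flags, and for each colour i
-- the i-adjacency r i (the perfect matching of colour i, as a fixed-point-free involution).
record Maniplex (n : ℕ) : Set₁ where
  field
    Flag    : Set
    r       : Fin n → Flag → Flag
    r-invol : ∀ i x → r i (r i x) ≡ x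
    r-fpf   : ∀ i x → r i x ≢ x
    r-simple : ∀ i j x → i ≢ j → r i x ≢ r j x
    -- |i-j| ≥ 2: each (i,j)-component is a 4-cycle (given the above, equivalent to commuting)
    r-comm  : ∀ i j x → FarApart i j → r i (r j x) ≡ r j (r i x)

  Step : (Fin n → Set) → Flag → Flag → Set
  Step allowed x y = ∃[ i ] (allowed i × r i x ≡ y)

  Edge : Flag → Flag → Set
  Edge x y = ∃[ i ] (r i x ≡ y)

  field
    connected : ∀ x y → Star Edge x y

  SameFace : Fin n → Flag → Flag → Set
  SameFace j = Star (Step (λ i → i ≢ j))

  record Aut : Set where
    field
      to       : Flag → Flag
      from     : Flag → Flag
      to-from  : ∀ x → to (from x) ≡ x
      from-to  : ∀ x → from (to x) ≡ x
      preserve : ∀ i x → to (r i x) ≡ r i (to x)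

  SameOrbit : Flag → Flag → Set
  SameOrbit x y = Σ Aut (λ φ → Aut.to φ x ≡ y)

  FaceTransitive : Fin n → Set
  FaceTransitive j = ∀ x y → Σ Aut (λ φ → SameFace j (Aut.to φ x) y)

  FullyTransitive : Set
  FullyTransitive = ∀ j → FaceTransitive j

  HasOrbits : ℕ → Set
  HasOrbits k = Σ (Fin k → Flag) λ f →
    (∀ a b → SameOrbit (f a) (f b) → a ≡ b) × (∀ x → ∃[ a ] SameOrbit (f a) x)

-- Each colour i induces an involution T i on the four flag orbits (the symmetry type graph),
-- and a path in the symmetry type graph avoiding colour j lifts to a path in a j-face.
-- So if deleting colour j leaves the symmetry type graph connected, M is j-face-transitive;
-- otherwise there is a cut for j: a nonempty proper set of orbits closed under every T i
-- with i ≠ j, which T j must leave. The cuts of distinct colours are independent, each being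
-- closed under the other colour's involution. An exhaustive search over the involutions and
-- subsets of a 4-element set shows that there are at most three independent cuts, and that
-- among three of them one involution commutes with neither of the other two. Since far apart
-- colours commute, those two colours are then the neighbours of the third.
module Submission where

open import Defs
open import Data.Nat using (ℕ; zero; suc; _+_; _≤_; _<_; z≤n; s≤s)
open import Data.Nat.Properties using (≤-antisym; ≤-trans; ≤-reflexive; +-suc; +-identityʳ; +-monoˡ-≤; m≤n+m)
open import Data.Fin using (Fin; zero; suc; toℕ; #_)
open import Data.Fin.Properties using (all?; any?; _≟_; ¬∀⟶∃¬; toℕ-injective)
open import Data.Fin.Subset using (Subset; inside; outside; _∈_; _∉_; _∪_; ∁; ⁅_⁆; ∣_∣; Nonempty)
open import Data.Fin.Subset.Properties
  using (_∈?_; anySubset?; nonempty?; ∈⊤; x∈⁅x⁆; x∈⁅y⁆⇒x≡y; p⊆p∪q; x∈p∪q⁺; x∈p∪q⁻; p⊂q⇒∣p∣<∣q∣; ∣p∣≤n; ∣p∣≡n⇒p≡⊤;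
         x∈∁p⇒x∉p; x∉p⇒x∈∁p; x∈p⇒x∉∁p; x∉∁p⇒x∈p)
open import Data.Vec using (Vec; []; _∷_; lookup; tabulate; here)
open import Data.Vec.Properties using (lookup∘tabulate; ≡-dec)
open import Data.List using (List; []; _∷_)
import Data.List.Relation.Unary.All as All
open import Data.List.Membership.DecPropositional (≡-dec {n = 4} (_≟_ {4}))
  using () renaming (_∈_ to _∈ˡ_; _∈?_ to _∈ˡ?_)
open import Data.Product using (∃; ∃₂; ∃-syntax; _×_; _,_; proj₁; proj₂)
open import Data.Sum using (_⊎_; inj₁; inj₂)
import Data.Sum as Sum
open import Data.Empty using (⊥; ⊥-elim)
open import Function using (_∘_; case_of_)
open import Level using (Level)
open import Relation.Nullary using (Dec; yes; no; ¬_)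
open import Relation.Nullary.Decidable using (_×-dec_; _⊎-dec_; _→-dec_; ¬?; map′; decidable-stable; toWitness)
open import Relation.Unary using (Pred; Decidable)
open import Relation.Binary using (Rel)
open import Relation.Binary.PropositionalEquality
  using (_≡_; _≢_; _≗_; refl; sym; trans; cong; subst; subst₂; ≢-sym; module ≡-Reasoning)
open import Relation.Binary.Construct.Closure.ReflexiveTransitive using (Star; ε; _◅_; _◅◅_; gmap; fold; reverse)

private variable
  p : Level
  k m n : ℕ

∀-Vec? : {P : Pred (Vec (Fin m) n) p} → Decidable P → Dec (∀ v → P v)
∀-Vec? {n = zero}  P? = map′ (λ P[] → λ { [] → P[] }) (λ ∀P → ∀P []) (P? [])
∀-Vec? {n = suc n} P? = map′ (λ ∀P → λ { (x ∷ v) → ∀P x v }) (λ ∀P x v → ∀P (x ∷ v))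
  (all? λ x → ∀-Vec? (P? ∘ (x ∷_)))

∀-Subset? : {P : Pred (Subset n) p} → Decidable P → Dec (∀ S → P S)
∀-Subset? {n = zero}  P? = map′ (λ P[] → λ { [] → P[] }) (λ ∀P → ∀P []) (P? [])
∀-Subset? {n = suc n} P? = map′ (λ (∀P₀ , ∀P₁) → λ { (outside ∷ S) → ∀P₀ S ; (inside ∷ S) → ∀P₁ S })
  (λ ∀P → (λ S → ∀P (outside ∷ S)) , (λ S → ∀P (inside ∷ S)))
  (∀-Subset? (P? ∘ (outside ∷_)) ×-dec ∀-Subset? (P? ∘ (inside ∷_)))

Involution : (Fin k → Fin k) → Set
Involution t = ∀ x → t (t x) ≡ x

involution? : (t : Fin k → Fin k) → Dec (Involution t)
involution? t = all? λ x → t (t x) ≟ x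

involution-resp : {s t : Fin k → Fin k} → s ≗ t → Involution s → Involution t
involution-resp {s = s} {t} s≗t invol x = begin
  t (t x) ≡⟨ cong t (sym (s≗t x)) ⟩
  t (s x) ≡⟨ sym (s≗t (s x)) ⟩
  s (s x) ≡⟨ invol x ⟩
  x       ∎
  where open ≡-Reasoning

ClosedUnder : (Fin k → Fin k) → Subset k → Set
ClosedUnder t S = ∀ x → x ∈ S → t x ∈ S

closedUnder? : (t : Fin k → Fin k) (S : Subset k) → Dec (ClosedUnder t S)
closedUnder? t S = all? λ x → x ∈? S →-dec t x ∈? S

closedUnder-resp : {s t : Fin k → Fin k} {S : Subset k} → s ≗ t → ClosedUnder s S → ClosedUnder t S
closedUnder-resp {S = S} s≗t closed x x∈S = subst (_∈ S) (s≗t x) (closed x x∈S)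

closedUnder-∁ : {t : Fin k → Fin k} {S : Subset k} → Involution t → ClosedUnder t S → ClosedUnder t (∁ S)
closedUnder-∁ {t = t} {S} invol closed x x∈∁S =
  x∉p⇒x∈∁p λ tx∈S → x∈∁p⇒x∉p x∈∁S (subst (_∈ S) (invol x) (closed (t x) tx∈S))

closedUnder-∁⁻ : {t : Fin k → Fin k} {S : Subset k} → Involution t → ClosedUnder t (∁ S) → ClosedUnder t S
closedUnder-∁⁻ {t = t} {S} invol closed x x∈S =
  x∉∁p⇒x∈p λ tx∈∁S → x∈p⇒x∉∁p x∈S (subst (_∈ ∁ S) (invol x) (closed (t x) tx∈∁S))

NonCommuting : (Fin k → Fin k) → (Fin k → Fin k) → Set
NonCommuting s t = ∃ λ x → s (t x) ≢ t (s x)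

nonCommuting? : (s t : Fin k → Fin k) → Dec (NonCommuting s t)
nonCommuting? s t = any? λ x → ¬? (s (t x) ≟ t (s x))

nonCommuting-resp : {s s′ t t′ : Fin k → Fin k} → s ≗ s′ → t ≗ t′ → NonCommuting s t → NonCommuting s′ t′
nonCommuting-resp {s = s} {s′} {t} {t′} s≗s′ t≗t′ (x , st≢ts) = x , λ s′t′≡t′s′ → st≢ts (begin
  s (t x)   ≡⟨ cong s (t≗t′ x) ⟩
  s (t′ x)  ≡⟨ s≗s′ (t′ x) ⟩
  s′ (t′ x) ≡⟨ s′t′≡t′s′ ⟩
  t′ (s′ x) ≡⟨ sym (t≗t′ (s′ x)) ⟩
  t (s′ x)  ≡⟨ cong t (sym (s≗s′ x)) ⟩
  t (s x)   ∎)
  where open ≡-Reasoning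

Central : (Fin k → Fin k) → (Fin k → Fin k) → (Fin k → Fin k) → Set
Central c s t = NonCommuting c s × NonCommuting c t

central? : (c s t : Fin k → Fin k) → Dec (Central c s t)
central? c s t = nonCommuting? c s ×-dec nonCommuting? c t

distinct-close⇒adjacent : ∀ p q → p ≢ q → ¬ ((p + 2 ≤ q) ⊎ (q + 2 ≤ p)) → q + 1 ≡ p ⊎ q ≡ p + 1
distinct-close⇒adjacent zero          zero          p≢q _   = ⊥-elim (p≢q refl)
distinct-close⇒adjacent zero          (suc zero)    _   _   = inj₂ refl
distinct-close⇒adjacent zero          (suc (suc q)) _   far = ⊥-elim (far (inj₁ (s≤s (s≤s z≤n))))
distinct-close⇒adjacent (suc zero)    zero          _   _   = inj₁ refl
distinct-close⇒adjacent (suc (suc p)) zero          _   far = ⊥-elim (far (inj₂ (s≤s (s≤s z≤n))))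
distinct-close⇒adjacent (suc p)       (suc q)       p≢q far =
  Sum.map (cong suc) (cong suc) (distinct-close⇒adjacent p q (p≢q ∘ cong suc) (far ∘ Sum.map s≤s s≤s))

Near : Fin n → Fin n → Set
Near c j = toℕ j + 1 ≡ toℕ c ⊎ j ≡ c ⊎ toℕ j ≡ toℕ c + 1

Near-refl : {c : Fin n} → Near c c
Near-refl = inj₂ (inj₁ refl)

off-center : {c j x : Fin n} → toℕ j + 1 ≢ toℕ c → j ≢ c → toℕ j ≢ toℕ c + 1 → Near c x → j ≢ x
off-center j+1≢c j≢c j≢c+1 near-x refl = Sum.[ j+1≢c , Sum.[ j≢c , j≢c+1 ] ] near-x

module Reachability {p} (step : Fin m → Fin k → Fin k) {Allowed : Pred (Fin m) p} (allowed? : Decidable Allowed) where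

  Edge : Rel (Fin k) p
  Edge x y = ∃ λ i → Allowed i × step i x ≡ y

  Closed : Subset k → Set p
  Closed S = ∀ i → Allowed i → ClosedUnder (step i) S

  closed? : (S : Subset k) → Dec (Closed S)
  closed? S = all? λ i → allowed? i →-dec closedUnder? (step i) S

  Separated : Fin k → Set p
  Separated x₀ = ∃ λ S → Closed S × x₀ ∈ S × ∃ (_∉ S)

  closed-or-exit : ∀ S → Closed S ⊎ ∃₂ λ x y → x ∈ S × y ∉ S × Edge x y
  closed-or-exit S with any? (λ i → allowed? i ×-dec any? λ x → x ∈? S ×-dec ¬? (step i x ∈? S))
  ... | yes (i , allowed , x , x∈S , y∉S) = inj₂ (x , step i x , x∈S , y∉S , i , allowed , refl)
  ... | no no-exit = inj₁ λ i allowed x x∈S →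
    decidable-stable (step i x ∈? S) λ y∉S → no-exit (i , allowed , x , x∈S , y∉S)

  private
    Reached : Fin k → Subset k → Set p
    Reached x₀ R = ∀ {y} → y ∈ R → Star Edge x₀ y

    full-if-large : {R : Subset k} → k ≤ ∣ R ∣ + 0 → ∀ y → y ∈ R
    full-if-large {R = R} large y =
      subst (y ∈_) (sym (∣p∣≡n⇒p≡⊤ (≤-antisym (∣p∣≤n R) (subst (k ≤_) (+-identityʳ _) large)))) ∈⊤

    ∣∪⁅y⁆∣ : {R : Subset k} {y : Fin k} → y ∉ R → ∣ R ∣ < ∣ R ∪ ⁅ y ⁆ ∣
    ∣∪⁅y⁆∣ {y = y} y∉R = p⊂q⇒∣p∣<∣q∣ (p⊆p∪q _ , y , x∈p∪q⁺ (inj₂ (x∈⁅x⁆ y)) , y∉R)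

    reached-∪⁅y⁆ : ∀ {x₀ x y R} → Reached x₀ R → x ∈ R → Edge x y → Reached x₀ (R ∪ ⁅ y ⁆)
    reached-∪⁅y⁆ {R = R} reached x∈R e z∈ with x∈p∪q⁻ R _ z∈
    ... | inj₁ z∈R  = reached z∈R
    ... | inj₂ z∈⁅y⁆ rewrite x∈⁅y⁆⇒x≡y _ z∈⁅y⁆ = reached x∈R ◅◅ (e ◅ ε)

    settle : ∀ {x₀} R → Closed R → x₀ ∈ R → Reached x₀ R → (∀ y → Star Edge x₀ y) ⊎ Separated x₀
    settle R closed x₀∈R reached with all? (_∈? R)
    ... | yes full = inj₁ λ y → reached (full y)
    ... | no ¬full = inj₂ (R , closed , x₀∈R , ¬∀⟶∃¬ k (_∈ R) (_∈? R) ¬full)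

    grow : ∀ {x₀} fuel R → k ≤ ∣ R ∣ + fuel → x₀ ∈ R → Reached x₀ R → (∀ y → Star Edge x₀ y) ⊎ Separated x₀
    grow fuel R large x₀∈R reached with closed-or-exit R | fuel
    ... | inj₁ closed | _ = settle R closed x₀∈R reached
    ... | inj₂ (_ , y , _ , y∉R , _) | zero = ⊥-elim (y∉R (full-if-large large y))
    ... | inj₂ (x , y , x∈R , y∉R , e) | suc fuel′ =
      grow fuel′ (R ∪ ⁅ y ⁆) large′ (p⊆p∪q _ x₀∈R) (reached-∪⁅y⁆ reached x∈R e)
      where
      large′ : k ≤ ∣ R ∪ ⁅ y ⁆ ∣ + fuel′
      large′ = ≤-trans large (≤-trans (≤-reflexive (+-suc ∣ R ∣ fuel′)) (+-monoˡ-≤ fuel′ (∣∪⁅y⁆∣ y∉R)))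

  reachable-or-separated : ∀ x₀ → (∀ y → Star Edge x₀ y) ⊎ Separated x₀
  reachable-or-separated x₀ = grow k ⁅ x₀ ⁆ (m≤n+m k _) (x∈⁅x⁆ x₀)
    λ y∈⁅x₀⁆ → subst (Star Edge x₀) (sym (x∈⁅y⁆⇒x≡y _ y∈⁅x₀⁆)) ε

record Bridge (k : ℕ) : Set where
  field
    table      : Vec (Fin k) k
    side       : Subset k
    involutive : Involution (lookup table)
    crossed    : ¬ ClosedUnder (lookup table) side

  act : Fin k → Fin k
  act = lookup table

open Bridge

Independent : Bridge k → Bridge k → Set
Independent a b = ClosedUnder (act a) (side b) × ClosedUnder (act b) (side a)

anchor : Subset (suc k) → Subset (suc k)
anchor (inside ∷ S)  = inside ∷ S
anchor (outside ∷ S) = ∁ (outside ∷ S)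

zero∈anchor : (S : Subset (suc k)) → zero ∈ anchor S
zero∈anchor (inside ∷ S)  = here
zero∈anchor (outside ∷ S) = here

closedUnder-anchor : {t : Fin (suc k) → Fin (suc k)} (S : Subset (suc k)) →
  Involution t → ClosedUnder t S → ClosedUnder t (anchor S)
closedUnder-anchor (inside ∷ S)  _     closed = closed
closedUnder-anchor (outside ∷ S) invol closed = closedUnder-∁ invol closed

-- Closure under an involution is invariant under complementation, so the exhaustive
-- search below only has to range over sides containing zero.
anchored : Bridge (suc k) → Bridge (suc k)
anchored b = record
  { table      = table b
  ; side       = anchor (side b)
  ; involutive = involutive b
  ; crossed    = crossed-anchor (side b) (crossed b)
  }
  where
  crossed-anchor : ∀ S → ¬ ClosedUnder (act b) S → ¬ ClosedUnder (act b) (anchor S)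
  crossed-anchor (inside ∷ S)  = λ ¬closed → ¬closed
  crossed-anchor (outside ∷ S) = λ ¬closed → ¬closed ∘ closedUnder-∁⁻ (involutive b)

independent-anchored : (a b : Bridge (suc k)) → Independent a b → Independent (anchored a) (anchored b)
independent-anchored a b (ab , ba) =
  closedUnder-anchor (side b) (involutive a) ab , closedUnder-anchor (side a) (involutive b) ba

private
  Table : Set
  Table = Vec (Fin 4) 4

  involutions : List Table
  involutions =
    (# 0 ∷ # 1 ∷ # 2 ∷ # 3 ∷ []) ∷
    (# 1 ∷ # 0 ∷ # 2 ∷ # 3 ∷ []) ∷ (# 2 ∷ # 1 ∷ # 0 ∷ # 3 ∷ []) ∷ (# 3 ∷ # 1 ∷ # 2 ∷ # 0 ∷ []) ∷
    (# 0 ∷ # 2 ∷ # 1 ∷ # 3 ∷ []) ∷ (# 0 ∷ # 3 ∷ # 2 ∷ # 1 ∷ []) ∷ (# 0 ∷ # 1 ∷ # 3 ∷ # 2 ∷ []) ∷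
    (# 1 ∷ # 0 ∷ # 3 ∷ # 2 ∷ []) ∷ (# 2 ∷ # 3 ∷ # 0 ∷ # 1 ∷ []) ∷ (# 3 ∷ # 2 ∷ # 1 ∷ # 0 ∷ []) ∷ []

  involutions-complete : ∀ t → Involution (lookup t) → t ∈ˡ involutions
  involutions-complete = toWitness {a? = ∀-Vec? λ t → involution? (lookup t) →-dec t ∈ˡ? involutions} _

  ∀-Involution? : {P : Pred Table p} → Decidable P → Dec (∀ t → Involution (lookup t) → P t)
  ∀-Involution? P? = map′ (λ all t invol → All.lookup all (involutions-complete t invol) invol)
    (λ ∀P → All.tabulate λ {t} _ → ∀P t) (All.all? (λ t → involution? (lookup t) →-dec P? t) involutions)

  NoFourIndependent : Set
  NoFourIndependent =
    ∀ (ta : Table) → Involution (lookup ta) → ∀ Sa → zero ∈ Sa → ¬ ClosedUnder (lookup ta) Sa →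
    ∀ (tb : Table) → Involution (lookup tb) → ClosedUnder (lookup tb) Sa →
    ∀ Sb → zero ∈ Sb → ¬ ClosedUnder (lookup tb) Sb → ClosedUnder (lookup ta) Sb →
    ∀ (tc : Table) → Involution (lookup tc) → ClosedUnder (lookup tc) Sa → ClosedUnder (lookup tc) Sb →
    ∀ Sc → zero ∈ Sc → ¬ ClosedUnder (lookup tc) Sc → ClosedUnder (lookup ta) Sc → ClosedUnder (lookup tb) Sc →
    ∀ (td : Table) → Involution (lookup td) →
    ClosedUnder (lookup td) Sa → ClosedUnder (lookup td) Sb → ClosedUnder (lookup td) Sc →
    ∀ Sd → zero ∈ Sd → ¬ ClosedUnder (lookup td) Sd →
    ClosedUnder (lookup ta) Sd → ClosedUnder (lookup tb) Sd → ClosedUnder (lookup tc) Sd → ⊥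

  noFourIndependent? : Dec NoFourIndependent
  noFourIndependent? =
    ∀-Involution? λ ta → ∀-Subset? λ Sa → zero ∈? Sa →-dec ¬? (closedUnder? (lookup ta) Sa) →-dec
    ∀-Involution? λ tb → (closedUnder? (lookup tb) Sa →-dec
    ∀-Subset? λ Sb → zero ∈? Sb →-dec ¬? (closedUnder? (lookup tb) Sb) →-dec (closedUnder? (lookup ta) Sb →-dec
    ∀-Involution? λ tc → (closedUnder? (lookup tc) Sa →-dec (closedUnder? (lookup tc) Sb →-dec
    ∀-Subset? λ Sc → zero ∈? Sc →-dec ¬? (closedUnder? (lookup tc) Sc) →-dec
      (closedUnder? (lookup ta) Sc →-dec (closedUnder? (lookup tb) Sc →-dec
    ∀-Involution? λ td →
      (closedUnder? (lookup td) Sa →-dec (closedUnder? (lookup td) Sb →-dec (closedUnder? (lookup td) Sc →-dec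
    ∀-Subset? λ Sd → zero ∈? Sd →-dec ¬? (closedUnder? (lookup td) Sd) →-dec
      (closedUnder? (lookup ta) Sd →-dec (closedUnder? (lookup tb) Sd →-dec (closedUnder? (lookup tc) Sd →-dec
    no λ absurd → absurd))))))))))))

  ThreeIndependent : Set
  ThreeIndependent =
    ∀ (ta : Table) → Involution (lookup ta) → ∀ Sa → zero ∈ Sa → ¬ ClosedUnder (lookup ta) Sa →
    ∀ (tb : Table) → Involution (lookup tb) → ClosedUnder (lookup tb) Sa →
    ∀ Sb → zero ∈ Sb → ¬ ClosedUnder (lookup tb) Sb → ClosedUnder (lookup ta) Sb →
    ∀ (tc : Table) → Involution (lookup tc) → ClosedUnder (lookup tc) Sa → ClosedUnder (lookup tc) Sb →
    ∀ Sc → zero ∈ Sc → ¬ ClosedUnder (lookup tc) Sc → ClosedUnder (lookup ta) Sc → ClosedUnder (lookup tb) Sc →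
    Central (lookup ta) (lookup tb) (lookup tc) ⊎ Central (lookup tb) (lookup ta) (lookup tc)
      ⊎ Central (lookup tc) (lookup ta) (lookup tb)

  threeIndependent? : Dec ThreeIndependent
  threeIndependent? =
    ∀-Involution? λ ta → ∀-Subset? λ Sa → zero ∈? Sa →-dec ¬? (closedUnder? (lookup ta) Sa) →-dec
    ∀-Involution? λ tb → (closedUnder? (lookup tb) Sa →-dec
    ∀-Subset? λ Sb → zero ∈? Sb →-dec ¬? (closedUnder? (lookup tb) Sb) →-dec (closedUnder? (lookup ta) Sb →-dec
    ∀-Involution? λ tc → (closedUnder? (lookup tc) Sa →-dec (closedUnder? (lookup tc) Sb →-dec
    ∀-Subset? λ Sc → zero ∈? Sc →-dec ¬? (closedUnder? (lookup tc) Sc) →-dec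
      (closedUnder? (lookup ta) Sc →-dec (closedUnder? (lookup tb) Sc →-dec
    (central? (lookup ta) (lookup tb) (lookup tc) ⊎-dec central? (lookup tb) (lookup ta) (lookup tc)
      ⊎-dec central? (lookup tc) (lookup ta) (lookup tb))))))))

  -- abstract, so that later conversion checks never unfold the witnesses and rerun the search
  abstract
    noFourIndependent : NoFourIndependent
    noFourIndependent = toWitness {a? = noFourIndependent?} _

    threeIndependent : ThreeIndependent
    threeIndependent = toWitness {a? = threeIndependent?} _

  no-four-anchored : (a b c d : Bridge 4) → zero ∈ side a → zero ∈ side b → zero ∈ side c → zero ∈ side d →
    Independent a b → Independent a c → Independent a d → Independent b c → Independent b d → Independent c d → ⊥
  no-four-anchored a b c d 0∈a 0∈b 0∈c 0∈d (ab , ba) (ac , ca) (ad , da) (bc , cb) (bd , db) (cd , dc) =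
    noFourIndependent
      (table a) (involutive a) (side a) 0∈a (crossed a)
      (table b) (involutive b) ba (side b) 0∈b (crossed b) ab
      (table c) (involutive c) ca cb (side c) 0∈c (crossed c) ac bc
      (table d) (involutive d) da db dc (side d) 0∈d (crossed d) ad bd cd

  three-anchored : (a b c : Bridge 4) → zero ∈ side a → zero ∈ side b → zero ∈ side c →
    Independent a b → Independent a c → Independent b c →
    Central (act a) (act b) (act c) ⊎ Central (act b) (act a) (act c) ⊎ Central (act c) (act a) (act b)
  three-anchored a b c 0∈a 0∈b 0∈c (ab , ba) (ac , ca) (bc , cb) =
    threeIndependent
      (table a) (involutive a) (side a) 0∈a (crossed a)
      (table b) (involutive b) ba (side b) 0∈b (crossed b) ab
      (table c) (involutive c) ca cb (side c) 0∈c (crossed c) ac bc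

no-four-independent-bridges : (a b c d : Bridge 4) →
  Independent a b → Independent a c → Independent a d → Independent b c → Independent b d → Independent c d → ⊥
no-four-independent-bridges a b c d ab ac ad bc bd cd =
  no-four-anchored (anchored a) (anchored b) (anchored c) (anchored d)
    (zero∈anchor (side a)) (zero∈anchor (side b)) (zero∈anchor (side c)) (zero∈anchor (side d))
    (independent-anchored a b ab) (independent-anchored a c ac) (independent-anchored a d ad)
    (independent-anchored b c bc) (independent-anchored b d bd) (independent-anchored c d cd)

three-independent-bridges : (a b c : Bridge 4) → Independent a b → Independent a c → Independent b c →
  Central (act a) (act b) (act c) ⊎ Central (act b) (act a) (act c) ⊎ Central (act c) (act a) (act b)
three-independent-bridges a b c ab ac bc =
  three-anchored (anchored a) (anchored b) (anchored c)
    (zero∈anchor (side a)) (zero∈anchor (side b)) (zero∈anchor (side c))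
    (independent-anchored a b ab) (independent-anchored a c ac) (independent-anchored b c bc)

module SymmetryTypeGraph {n} (M : Maniplex n) {k} (orbits : Maniplex.HasOrbits M k) where
  open Maniplex M

  _∘ᵃ_ : Aut → Aut → Aut
  φ ∘ᵃ ψ = record
    { to       = Aut.to φ ∘ Aut.to ψ
    ; from     = Aut.from ψ ∘ Aut.from φ
    ; to-from  = λ x → trans (cong (Aut.to φ) (Aut.to-from ψ _)) (Aut.to-from φ x)
    ; from-to  = λ x → trans (cong (Aut.from ψ) (Aut.from-to φ _)) (Aut.from-to ψ x)
    ; preserve = λ i x → trans (cong (Aut.to φ) (Aut.preserve ψ i x)) (Aut.preserve φ i _)
    }

  _⁻¹ᵃ : Aut → Aut
  φ ⁻¹ᵃ = record
    { to       = Aut.from φ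
    ; from     = Aut.to φ
    ; to-from  = Aut.from-to φ
    ; from-to  = Aut.to-from φ
    ; preserve = λ i x → begin
        Aut.from φ (r i x)                          ≡⟨ cong (Aut.from φ ∘ r i) (sym (Aut.to-from φ x)) ⟩
        Aut.from φ (r i (Aut.to φ (Aut.from φ x)))  ≡⟨ cong (Aut.from φ) (sym (Aut.preserve φ i _)) ⟩
        Aut.from φ (Aut.to φ (r i (Aut.from φ x)))  ≡⟨ Aut.from-to φ _ ⟩
        r i (Aut.from φ x)                          ∎
    }
    where open ≡-Reasoning

  sameOrbit-sym : ∀ {x y} → SameOrbit x y → SameOrbit y x
  sameOrbit-sym {x} (φ , φx≡y) = φ ⁻¹ᵃ , trans (cong (Aut.from φ) (sym φx≡y)) (Aut.from-to φ x)

  sameOrbit-trans : ∀ {x y z} → SameOrbit x y → SameOrbit y z → SameOrbit x z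
  sameOrbit-trans (φ , φx≡y) (ψ , ψy≡z) = ψ ∘ᵃ φ , trans (cong (Aut.to ψ) φx≡y) ψy≡z

  representative : Fin k → Flag
  representative = proj₁ orbits

  orbit : Flag → Fin k
  orbit x = proj₁ (proj₂ (proj₂ orbits) x)

  representative-orbit : ∀ x → SameOrbit (representative (orbit x)) x
  representative-orbit x = proj₂ (proj₂ (proj₂ orbits) x)

  sameOrbit⇒orbit≡ : ∀ {x y} → SameOrbit x y → orbit x ≡ orbit y
  sameOrbit⇒orbit≡ {x} {y} x∼y = proj₁ (proj₂ orbits) _ _
    (sameOrbit-trans (representative-orbit x) (sameOrbit-trans x∼y (sameOrbit-sym (representative-orbit y))))

  orbit≡⇒sameOrbit : ∀ {x y} → orbit x ≡ orbit y → SameOrbit x y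
  orbit≡⇒sameOrbit {x} {y} eq = sameOrbit-trans (sameOrbit-sym (representative-orbit x))
    (subst (λ a → SameOrbit (representative a) y) (sym eq) (representative-orbit y))

  orbit-representative : ∀ a → orbit (representative a) ≡ a
  orbit-representative a = proj₁ (proj₂ orbits) _ _ (representative-orbit (representative a))

  T : Fin n → Fin k → Fin k
  T i a = orbit (r i (representative a))

  orbit-r : ∀ i x → orbit (r i x) ≡ T i (orbit x)
  orbit-r i x = sym (sameOrbit⇒orbit≡ (φ , trans (Aut.preserve φ i _) (cong (r i) φa≡x)))
    where
    φ = proj₁ (representative-orbit x)
    φa≡x = proj₂ (representative-orbit x)

  T-involution : ∀ i → Involution (T i)
  T-involution i a = begin
    T i (T i a)                           ≡⟨ orbit-r i (r i (representative a)) ⟨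
    orbit (r i (r i (representative a)))  ≡⟨ cong orbit (r-invol i _) ⟩
    orbit (representative a)              ≡⟨ orbit-representative a ⟩
    a                                     ∎
    where open ≡-Reasoning

  T-comm : ∀ i j a → FarApart i j → T i (T j a) ≡ T j (T i a)
  T-comm i j a far = begin
    T i (T j a)                                ≡⟨ orbit-r i _ ⟨
    orbit (r i (r j (representative a)))       ≡⟨ cong orbit (r-comm i j _ far) ⟩
    orbit (r j (r i (representative a)))       ≡⟨ orbit-r j _ ⟩
    T j (T i a)                                ∎
    where open ≡-Reasoning

  symmetry-type-graph-connected : ∀ a b → Star (λ a b → ∃ λ i → T i a ≡ b) a b
  symmetry-type-graph-connected a b = subst₂ (Star _) (orbit-representative a) (orbit-representative b)
    (gmap orbit (λ {x} (i , rix≡y) → i , trans (sym (orbit-r i x)) (cong orbit rix≡y))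
      (connected (representative a) (representative b)))

  module Avoiding (j : Fin n) = Reachability T (λ i → ¬? (i ≟ j))

  lift : ∀ j y {a b} → orbit y ≡ a → Star (Avoiding.Edge j) a b → ∃ λ y′ → SameFace j y y′ × orbit y′ ≡ b
  lift j y y∈a ε = y , ε , y∈a
  lift j y y∈a ((i , i≢j , e) ◅ path) with lift j (r i y) (trans (orbit-r i y) (trans (cong (T i) y∈a) e)) path
  ... | y′ , face , y′∈b = y′ , (i , i≢j , refl) ◅ face , y′∈b

  Cut : Fin n → Set
  Cut j = ∃ λ S → Avoiding.Closed j S × Nonempty S × ∃ (_∉ S)

  cut? : ∀ j → Dec (Cut j)
  cut? j = anySubset? λ S → Avoiding.closed? j S ×-dec nonempty? S ×-dec any? (λ x → ¬? (x ∈? S))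

  face-transitive-if-no-cut : ∀ {j} → ¬ Cut j → FaceTransitive j
  face-transitive-if-no-cut {j} ¬cut x y with Avoiding.reachable-or-separated j (orbit y)
  ... | inj₂ (S , closed , y∈S , missing) = ⊥-elim (¬cut (S , closed , (orbit y , y∈S) , missing))
  ... | inj₁ reach with lift j y refl (reach (orbit x))
  ...   | y′ , face , y′∼x with orbit≡⇒sameOrbit (sym y′∼x)
  ...     | φ , φx≡y′ = φ , subst (λ z → SameFace j z y) (sym φx≡y′) (reverse flip face)
    where
    flip : ∀ {u v} → Step (_≢ j) u v → Step (_≢ j) v u
    flip (i , i≢j , e) = i , i≢j , trans (cong (r i) (sym e)) (r-invol i _)

  cut-crossed : ∀ {j} ((S , _) : Cut j) → ¬ ClosedUnder (T j) S
  cut-crossed {j} (S , closed , (x , x∈S) , (y , y∉S)) closedⱼ =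
    y∉S (fold (λ a b → a ∈ S → b ∈ S) (λ (i , e) next a∈S → next (subst (_∈ S) e (closed-all i _ a∈S)))
      (λ a∈S → a∈S) (symmetry-type-graph-connected x y) x∈S)
    where
    closed-all : ∀ i → ClosedUnder (T i) S
    closed-all i with i ≟ j
    ... | yes refl = closedⱼ
    ... | no i≢j = closed i i≢j

  near-if-nonCommuting : ∀ {c j} → j ≢ c → NonCommuting (T c) (T j) → Near c j
  near-if-nonCommuting {c} {j} j≢c (x , ne) =
    Sum.map₂ inj₂ (distinct-close⇒adjacent (toℕ c) (toℕ j) (≢-sym j≢c ∘ toℕ-injective) λ far → ne (T-comm c j x far))

module FourOrbits {n} (M : Maniplex n) (orbits : Maniplex.HasOrbits M 4) where
  open Maniplex M
  open SymmetryTypeGraph M orbits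

  bridge : ∀ {j} → Cut j → Bridge 4
  bridge {j} c@(S , _) = record
    { table      = tabulate (T j)
    ; side       = S
    ; involutive = involution-resp (sym ∘ lookup∘tabulate (T j)) (T-involution j)
    ; crossed    = cut-crossed c ∘ closedUnder-resp (lookup∘tabulate (T j))
    }

  independent : ∀ {i j} (ci : Cut i) (cj : Cut j) → j ≢ i → Independent (bridge ci) (bridge cj)
  independent {i} {j} (_ , closedᵢ , _) (_ , closedⱼ , _) j≢i =
    closedUnder-resp (sym ∘ lookup∘tabulate (T i)) (closedⱼ i (≢-sym j≢i)) ,
    closedUnder-resp (sym ∘ lookup∘tabulate (T j)) (closedᵢ j j≢i)

  no-four-cuts : ∀ {a b c d} → b ≢ a → c ≢ a → c ≢ b → d ≢ a → d ≢ b → d ≢ c →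
    Cut a → Cut b → Cut c → ¬ Cut d
  no-four-cuts b≢a c≢a c≢b d≢a d≢b d≢c ca cb cc cd =
    no-four-independent-bridges (bridge ca) (bridge cb) (bridge cc) (bridge cd)
    (independent ca cb b≢a) (independent ca cc c≢a) (independent ca cd d≢a)
    (independent cb cc c≢b) (independent cb cd d≢b) (independent cc cd d≢c)

  bridges-near : ∀ {m j} (cm : Cut m) (cj : Cut j) → j ≢ m →
    NonCommuting (act (bridge cm)) (act (bridge cj)) → Near m j
  bridges-near {m} {j} _ _ j≢m =
    near-if-nonCommuting j≢m ∘ nonCommuting-resp (lookup∘tabulate (T m)) (lookup∘tabulate (T j))

  three-cuts-near : ∀ {a b c} → b ≢ a → c ≢ a → c ≢ b → Cut a → Cut b → Cut c →
    ∃ λ m → Near m a × Near m b × Near m c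
  three-cuts-near {a} {b} {c} b≢a c≢a c≢b ca cb cc
    with three-independent-bridges (bridge ca) (bridge cb) (bridge cc)
           (independent ca cb b≢a) (independent ca cc c≢a) (independent cb cc c≢b)
  ... | inj₁ (ab , ac)          = a , Near-refl , bridges-near ca cb b≢a ab , bridges-near ca cc c≢a ac
  ... | inj₂ (inj₁ (ba , bc))   = b , bridges-near cb ca (≢-sym b≢a) ba , Near-refl , bridges-near cb cc c≢b bc
  ... | inj₂ (inj₂ (ca′ , cb′)) = c , bridges-near cc ca (≢-sym c≢a) ca′ , bridges-near cc cb (≢-sym c≢b) cb′ , Near-refl

theorem4p7 : (n : ℕ) (M : Maniplex n) → Maniplex.HasOrbits M 4 →
    Maniplex.FullyTransitive M
    ⊎ (∃[ i ] (∀ j → j ≢ i → Maniplex.FaceTransitive M j))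
    ⊎ (∃[ i ] ∃[ k ] (i ≢ k × (∀ j → j ≢ i → j ≢ k → Maniplex.FaceTransitive M j)))
    ⊎ (∃[ i ] (∀ j → toℕ j + 1 ≢ toℕ i → j ≢ i → toℕ j ≢ toℕ i + 1 → Maniplex.FaceTransitive M j))
theorem4p7 n M orbits = case any? cut? of λ where
    (no no-cut) → inj₁ λ j → face-transitive-if-no-cut λ cj → no-cut (j , cj)
    (yes (a , ca)) → case any? (λ j → ¬? (j ≟ a) ×-dec cut? j) of λ where
      (no no-cut) → inj₂ (inj₁ (a , λ j j≢a → face-transitive-if-no-cut λ cj → no-cut (j , j≢a , cj)))
      (yes (b , b≢a , cb)) → case any? (λ j → ¬? (j ≟ a) ×-dec ¬? (j ≟ b) ×-dec cut? j) of λ where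
        (no no-cut) → inj₂ (inj₂ (inj₁ (a , b , ≢-sym b≢a , λ j j≢a j≢b →
          face-transitive-if-no-cut λ cj → no-cut (j , j≢a , j≢b , cj))))
        (yes (c , c≢a , c≢b , cc)) → case three-cuts-near b≢a c≢a c≢b ca cb cc of λ where
          (m , near-a , near-b , near-c) → inj₂ (inj₂ (inj₂ (m , λ j j+1≢m j≢m j≢m+1 →
            let off : ∀ {x} → Near m x → j ≢ x
                off = off-center j+1≢m j≢m j≢m+1
            in
            face-transitive-if-no-cut (no-four-cuts b≢a c≢a c≢b (off near-a) (off near-b) (off near-c) ca cb cc))))
  where
  open SymmetryTypeGraph M orbits
  open FourOrbits M orbits
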